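{- For a niche-realizable graph $G$, each component of $G$ has at most $2\omega(G)$ vertices and $|V(G)|\le 4\omega(G)$, where $\omega(G)$ is the size of a maximum clique of $G$.
   Context: All graphs are simple. A bipartite tournament is an orientation of a complete bipartite graph. The niche graph of a digraph $D$ is the graph with vertex set $V(D)$ in which distinct $u,v$ are adjacent iff there is a vertex $w$ with $(u,w),(v,w)\in A(D)$, or with $(w,u),(w,v)\in A(D)$. A graph is niche-realizable if it is the niche graph of some bipartite tournament. -}

module Defs where

open import Data.Nat using (ℕ; _≤_)
open import Data.Bool using (Bool; true; false)
open import Data.Fin using (Fin)
open import Data.Fin.Subset using (Subset; _∈_; ∣_∣)
open import Data.Product using (Σ; ∃; ∃-syntax; _×_; _,_)
open import Data.Sum using (_⊎_)
open import Relation.Nullary using (¬_)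
open import Relation.Binary.PropositionalEquality using (_≡_; _≢_)
open import Relation.Binary.Construct.Closure.ReflexiveTransitive using (Star)
open import Function.Bundles using (_⇔_)

record Graph (n : ℕ) : Set₁ where
  field
    Adj    : Fin n → Fin n → Set
    sym    : ∀ {u v} → Adj u v → Adj v u
    irrefl : ∀ {u} → ¬ Adj u u
open Graph public

record BipartiteTournament (n : ℕ) : Set₁ where
  field
    side        : Fin n → Bool
    partTrue    : ∃[ v ] side v ≡ true
    partFalse   : ∃[ v ] side v ≡ false
    Arc         : Fin n → Fin n → Set
    noArcInPart : ∀ {u v} → side u ≡ side v → ¬ Arc u v
    oriented    : ∀ {u v} → side u ≢ side v → Arc u v ⊎ Arc v u
    asym        : ∀ {u v} → Arc u v → ¬ Arc v u
open BipartiteTournament public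

NicheAdj : ∀ {n} → BipartiteTournament n → Fin n → Fin n → Set
NicheAdj D u v =
  u ≢ v × ((∃[ w ] (Arc D u w × Arc D v w)) ⊎ (∃[ w ] (Arc D w u × Arc D w v)))

IsNicheGraphOf : ∀ {n} → Graph n → BipartiteTournament n → Set
IsNicheGraphOf G D = ∀ u v → Adj G u v ⇔ NicheAdj D u v

NicheRealizable : ∀ {n} → Graph n → Set₁
NicheRealizable {n} G = Σ (BipartiteTournament n) (IsNicheGraphOf G)

IsClique : ∀ {n} → Graph n → Subset n → Set
IsClique G S = ∀ {u v} → u ∈ S → v ∈ S → u ≢ v → Adj G u v

IsCliqueNumber : ∀ {n} → Graph n → ℕ → Set
IsCliqueNumber G k =
  (∃[ S ] (IsClique G S × ∣ S ∣ ≡ k)) × (∀ S → IsClique G S → ∣ S ∣ ≤ k)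

Connected : ∀ {n} → Graph n → Fin n → Fin n → Set
Connected G = Star (Adj G)

InComponentOf : ∀ {n} → Graph n → Fin n → Subset n → Set
InComponentOf G v S = ∀ {u} → u ∈ S → Connected G v u

-- Niche adjacency keeps both endpoints in the same part of the bipartition, since a
-- common in- or out-neighbour lies in the other part; so every component lies inside
-- one part. Any vertex w of the other part is joined by an arc to each vertex of a
-- part, which splits that part into the in-neighbours and the out-neighbours of w,
-- both cliques of the niche graph. Hence a part, and so a component, has at most 2ω
-- vertices, and the two parts together at most 4ω.
module Submission where

open import Defs
open import Data.Nat using (ℕ; _≤_; _*_)
open import Data.Fin.Subset using (Subset; ∣_∣)
open import Data.Fin using (Fin)
open import Data.Product using (_×_)

open import Level using (Level)
open import Data.Nat as ℕ using (_+_; z≤n; s≤s)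
open import Data.Nat.Properties
  using (≤-trans; +-mono-≤; +-suc; +-identityʳ; *-distribʳ-+; module ≤-Reasoning)
open import Data.Bool using (true; false; not)
open import Data.Bool.Properties using (¬-not; not-¬)
open import Data.Fin using (zero; suc)
open import Data.Fin.Subset using (_∈_; Lift; ⊤; inside; outside)
open import Data.Fin.Subset.Properties using (∣⊤∣≡n)
open import Data.Vec using ([]; _∷_; here; there)
open import Data.Product using (Σ-syntax; ∃-syntax; _,_; proj₁; proj₂)
open import Data.Sum using (_⊎_; inj₁; inj₂)
open import Relation.Unary using (Pred)
open import Relation.Binary.PropositionalEquality
  using (_≡_; _≢_; refl; trans; cong; ≢-sym; subst)
  renaming (sym to ≡-sym)
open import Relation.Binary.Construct.Closure.ReflexiveTransitive using (ε; _◅_)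
open import Function using (_∘_)
open import Function.Bundles using (Equivalence)

private
  variable
    ℓ : Level
    n : ℕ

Lift-outside : ∀ {P : Pred (Fin (ℕ.suc n)) ℓ} {A : Subset n} →
               Lift (P ∘ suc) A → Lift P (outside ∷ A)
Lift-outside pA (there m) = pA m

Lift-inside : ∀ {P : Pred (Fin (ℕ.suc n)) ℓ} {A : Subset n} →
              P zero → Lift (P ∘ suc) A → Lift P (inside ∷ A)
Lift-inside p pA here      = p
Lift-inside p pA (there m) = pA m

split-by-cover : ∀ {P Q : Pred (Fin n) ℓ} (S : Subset n) → (∀ {u} → u ∈ S → P u ⊎ Q u) →
                 Σ[ A ∈ Subset n ] Σ[ B ∈ Subset n ] Lift P A × Lift Q B × ∣ S ∣ ≤ ∣ A ∣ + ∣ B ∣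
split-by-cover             []            cover = [] , [] , (λ ()) , (λ ()) , z≤n
split-by-cover {P = P} {Q} (outside ∷ S) cover
  with A , B , pA , qB , S≤A+B ← split-by-cover {P = P ∘ suc} {Q ∘ suc} S (cover ∘ there)
  = outside ∷ A , outside ∷ B , Lift-outside {P = P} pA , Lift-outside {P = Q} qB , S≤A+B
split-by-cover {P = P} {Q} (inside ∷ S)  cover
  with A , B , pA , qB , S≤A+B ← split-by-cover {P = P ∘ suc} {Q ∘ suc} S (cover ∘ there)
     | cover here
... | inj₁ p = inside ∷ A , outside ∷ B , Lift-inside {P = P} p pA , Lift-outside {P = Q} qB ,
               s≤s S≤A+B
... | inj₂ q = outside ∷ A , inside ∷ B , Lift-outside {P = P} pA , Lift-inside {P = Q} q qB ,
               subst (ℕ.suc ∣ S ∣ ≤_) (≡-sym (+-suc ∣ A ∣ ∣ B ∣)) (s≤s S≤A+B)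

cover⇒∣S∣≤a+b : ∀ {P Q : Pred (Fin n) ℓ} {a b} (S : Subset n) → (∀ {u} → u ∈ S → P u ⊎ Q u) →
                (∀ A → Lift P A → ∣ A ∣ ≤ a) → (∀ B → Lift Q B → ∣ B ∣ ≤ b) → ∣ S ∣ ≤ a + b
cover⇒∣S∣≤a+b S cover boundP boundQ
  with A , B , pA , qB , S≤A+B ← split-by-cover S cover
  = ≤-trans S≤A+B (+-mono-≤ (boundP A pA) (boundQ B qB))

module _ (D : BipartiteTournament n) where

  arc⇒sideDiffers : ∀ {u v} → Arc D u v → side D u ≢ side D v
  arc⇒sideDiffers a same = noArcInPart D same a

  commonOutNeighbour⇒sameSide : ∀ {u v w} → Arc D u w → Arc D v w → side D u ≡ side D v
  commonOutNeighbour⇒sameSide uw vw =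
    trans (¬-not (arc⇒sideDiffers uw)) (≡-sym (¬-not (arc⇒sideDiffers vw)))

  commonInNeighbour⇒sameSide : ∀ {u v w} → Arc D w u → Arc D w v → side D u ≡ side D v
  commonInNeighbour⇒sameSide wu wv =
    trans (¬-not (≢-sym (arc⇒sideDiffers wu))) (≡-sym (¬-not (≢-sym (arc⇒sideDiffers wv))))

  nicheAdj⇒sameSide : ∀ {u v} → NicheAdj D u v → side D u ≡ side D v
  nicheAdj⇒sameSide (_ , inj₁ (_ , uw , vw)) = commonOutNeighbour⇒sameSide uw vw
  nicheAdj⇒sameSide (_ , inj₂ (_ , wu , wv)) = commonInNeighbour⇒sameSide wu wv

  vertexOnSide : ∀ s → ∃[ w ] side D w ≡ s
  vertexOnSide true  = partTrue D
  vertexOnSide false = partFalse D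

module _ (G : Graph n) (D : BipartiteTournament n) (niche : IsNicheGraphOf G D) where

  connected⇒sameSide : ∀ {u v} → Connected G u v → side D u ≡ side D v
  connected⇒sameSide ε       = refl
  connected⇒sameSide (a ◅ p) =
    trans (nicheAdj⇒sameSide D (Equivalence.to (niche _ _) a)) (connected⇒sameSide p)

  inNeighbours-clique : ∀ w A → Lift (λ u → Arc D u w) A → IsClique G A
  inNeighbours-clique w A arcs u∈A v∈A u≢v =
    Equivalence.from (niche _ _) (u≢v , inj₁ (w , arcs u∈A , arcs v∈A))

  outNeighbours-clique : ∀ w A → Lift (Arc D w) A → IsClique G A
  outNeighbours-clique w A arcs u∈A v∈A u≢v =
    Equivalence.from (niche _ _) (u≢v , inj₂ (w , arcs u∈A , arcs v∈A))

  oneSide⇒∣S∣≤2ω : ∀ {ω} → IsCliqueNumber G ω → ∀ s (S : Subset n) →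
                   Lift (λ u → side D u ≡ s) S → ∣ S ∣ ≤ 2 * ω
  oneSide⇒∣S∣≤2ω {ω} (_ , maxClique) s S onSide =
    subst (∣ S ∣ ≤_) (cong (ω +_) (≡-sym (+-identityʳ ω)))
      (cover⇒∣S∣≤a+b S arcWithW
        (λ A arcs → maxClique A (inNeighbours-clique w A arcs))
        (λ B arcs → maxClique B (outNeighbours-clique w B arcs)))
    where
    w : Fin n
    w = proj₁ (vertexOnSide D (not s))
    arcWithW : ∀ {u} → u ∈ S → Arc D u w ⊎ Arc D w u
    arcWithW u∈S = oriented D λ same →
      not-¬ (onSide u∈S) (trans same (proj₂ (vertexOnSide D (not s))))

proposition4p4 : ∀ {n} (G : Graph n) → NicheRealizable G → ∀ ω → IsCliqueNumber G ω →
    (∀ (v : Fin n) (S : Subset n) → InComponentOf G v S → ∣ S ∣ ≤ 2 * ω) × n ≤ 4 * ω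
proposition4p4 {n} G (D , niche) ω isω = componentBound , orderBound
  where
  componentBound : ∀ v S → InComponentOf G v S → ∣ S ∣ ≤ 2 * ω
  componentBound v S inComponent =
    oneSide⇒∣S∣≤2ω G D niche isω (side D v) S
      λ u∈S → ≡-sym (connected⇒sameSide G D niche (inComponent u∈S))

  eitherSide : ∀ {u} → u ∈ ⊤ → side D u ≡ true ⊎ side D u ≡ false
  eitherSide {u} _ with side D u
  ... | true  = inj₁ refl
  ... | false = inj₂ refl

  orderBound : n ≤ 4 * ω
  orderBound = begin
    n                 ≡⟨ ∣⊤∣≡n n ⟨
    ∣ ⊤ {n} ∣         ≤⟨ cover⇒∣S∣≤a+b ⊤ eitherSide (oneSide⇒∣S∣≤2ω G D niche isω true)
                                                     (oneSide⇒∣S∣≤2ω G D niche isω false) ⟩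
    2 * ω + 2 * ω     ≡⟨ *-distribʳ-+ ω 2 2 ⟨
    4 * ω             ∎
    where open ≤-Reasoning
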